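{- Suppose the entries of two $n\times n$ Boolean matrices $A$ and $B$ are drawn uniformly and independently at random. Then the expected running time of algorithm QuickMultiply on $(A,B)$ is $O(n^2)$.
   Context: Algorithm QuickMultiply$(A,B)$, for $A=(a_{i,j})$, $B=(b_{i,j})$ Boolean $n\times n$ matrices, computes the Boolean product $C=(c_{i,j})$ as follows: for $i=1,\ldots,n$, let $j_1<\cdots<j_m$ be the indices with $a_{i,j_k}=1$; then for $j=1,\ldots,n$, search the list $b_{j_1,j},\ldots,b_{j_m,j}$ sequentially (in this order) for a bit $1$, and set $c_{i,j}=1$ if a $1$ is found and $c_{i,j}=0$ otherwise. Running time counts the elementary steps, in particular every bit examined in the sequential searches. -}

module Defs where

open import Data.Bool using (Bool; true; false)
open import Data.Nat using (ℕ; zero; suc; _+_; _*_; _^_)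
open import Data.List using (List; []; _∷_; map; concatMap; allFin)
open import Data.Nat.ListAction using (sum)
open import Data.Vec using (Vec; []; _∷_; lookup)
import Data.Vec as V
open import Data.Fin using (Fin)

-- Boolean n×n matrix: a vector of n rows, each a vector of n bits.
-- Entry (i,j) is  lookup (lookup A i) j .
BoolMatrix : ℕ → Set
BoolMatrix n = Vec (Vec Bool n) n

allVecs : {A : Set} → List A → (k : ℕ) → List (Vec A k)
allVecs xs zero    = [] ∷ []
allVecs xs (suc k) = concatMap (λ x → map (x ∷_) (allVecs xs k)) xs

allBoolMatrices : (n : ℕ) → List (BoolMatrix n)
allBoolMatrices n = allVecs (allVecs (true ∷ false ∷ []) n) n

-- The list b_{j_1,j}, …, b_{j_m,j}: bits of column j of B at the
-- positions k (in increasing order) where the row a_i has a 1.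
keepWhere : {m : ℕ} → Vec Bool m → Vec Bool m → List Bool
keepWhere []          []       = []
keepWhere (true ∷ as)  (b ∷ bs) = b ∷ keepWhere as bs
keepWhere (false ∷ as) (b ∷ bs) = keepWhere as bs

column : {n : ℕ} → BoolMatrix n → Fin n → Vec Bool n
column B j = V.map (λ r → lookup r j) B

examined : List Bool → ℕ
examined []           = 0
examined (true ∷ _)   = 1
examined (false ∷ bs) = suc (examined bs)

-- Running time of QuickMultiply on (A,B): for each row i, n steps to
-- scan row i of A for its 1-entries; for each j, one step of overhead
-- plus every bit examined in the sequential search.
quickMultiplyCost : {n : ℕ} → BoolMatrix n → BoolMatrix n → ℕ
quickMultiplyCost {n} A B =
  sum (map (λ i → n + sum (map (λ j →
        suc (examined (keepWhere (lookup A i) (column B j)))) (allFin n)))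
      (allFin n))

-- Total running time over all pairs (A,B); the expected running time
-- under the uniform distribution is  totalCost n / 2 ^ (2 * n * n).
totalCost : ℕ → ℕ
totalCost n = sum (concatMap (λ A → map (λ B → quickMultiplyCost A B)
                                         (allBoolMatrices n))
                             (allBoolMatrices n))

-- For a fixed row a of A, the search in column j of B scans the bits of that column at the
-- positions of the 1s of a. Every column of a uniformly random matrix is a uniformly random
-- bit vector, so this is a sequence of independent fair bits, and the search for the first 1
-- among them examines fewer than 2 bits on average. Hence each of the n² searches costs O(1)
-- in expectation, and the n scans of the rows of A add n² more.
module Submission where

open import Defs
open import Data.Nat using (ℕ; zero; suc; _+_; _*_; _^_; _≤_; z≤n; NonZero)
open import Data.Nat.Properties
open import Data.Nat.ListAction using (sum)
open import Data.Nat.ListAction.Properties using (sum-++)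
open import Data.Nat.Tactic.RingSolver using (solve-∀)
open import Algebra.Properties.CommutativeSemigroup +-commutativeSemigroup
  using () renaming (interchange to +-interchange)
open import Algebra.Properties.CommutativeSemigroup *-commutativeSemigroup
  using (x∙yz≈y∙xz)
open import Data.Bool using (Bool; true; false)
open import Data.List using (List; []; _∷_; map; concatMap; length; allFin)
open import Data.List.Properties using (map-cong; map-∘; map-concatMap; length-tabulate)
open import Data.Vec using (Vec; []; _∷_; lookup)
import Data.Vec as V
open import Data.Fin using (Fin; zero; suc)
open import Data.Product using (∃; _,_)
open import Function using (_∘_)
open import Relation.Binary.PropositionalEquality

private
  variable
    A B : Set

∑ : List A → (A → ℕ) → ℕ
∑ xs f = sum (map f xs)

syntax ∑ xs (λ x → e) = ∑[ x ← xs ] e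

∑-cong : (xs : List A) {f g : A → ℕ} → (∀ x → f x ≡ g x) → ∑ xs f ≡ ∑ xs g
∑-cong xs f≗g = cong sum (map-cong f≗g xs)

∑-mono-≤ : (xs : List A) {f g : A → ℕ} → (∀ x → f x ≤ g x) → ∑ xs f ≤ ∑ xs g
∑-mono-≤ []       f≤g = z≤n
∑-mono-≤ (x ∷ xs) f≤g = +-mono-≤ (f≤g x) (∑-mono-≤ xs f≤g)

∑-const : (xs : List A) (c : ℕ) → ∑[ x ← xs ] c ≡ length xs * c
∑-const []       c = refl
∑-const (x ∷ xs) c = cong (c +_) (∑-const xs c)

∑-one : (xs : List A) → ∑[ x ← xs ] 1 ≡ length xs
∑-one xs = trans (∑-const xs 1) (*-identityʳ (length xs))

∑-bound : (xs : List A) {f : A → ℕ} {c : ℕ} → (∀ x → f x ≤ c) → ∑ xs f ≤ length xs * c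
∑-bound xs {c = c} f≤c = ≤-trans (∑-mono-≤ xs f≤c) (≤-reflexive (∑-const xs c))

∑-distrib-+ : (xs : List A) (f g : A → ℕ) → ∑[ x ← xs ] (f x + g x) ≡ ∑ xs f + ∑ xs g
∑-distrib-+ []       f g = refl
∑-distrib-+ (x ∷ xs) f g =
  trans (cong (f x + g x +_) (∑-distrib-+ xs f g)) (+-interchange (f x) (g x) (∑ xs f) (∑ xs g))

∑-suc : (xs : List A) (f : A → ℕ) → ∑[ x ← xs ] suc (f x) ≡ length xs + ∑ xs f
∑-suc xs f = trans (∑-distrib-+ xs (λ _ → 1) f) (cong (_+ ∑ xs f) (∑-one xs))

∑-*ˡ : (xs : List A) (c : ℕ) (f : A → ℕ) → ∑[ x ← xs ] (c * f x) ≡ c * ∑ xs f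
∑-*ˡ []       c f = sym (*-zeroʳ c)
∑-*ˡ (x ∷ xs) c f = trans (cong (c * f x +_) (∑-*ˡ xs c f)) (sym (*-distribˡ-+ c (f x) (∑ xs f)))

∑-swap : (xs : List A) (ys : List B) (f : A → B → ℕ) →
         ∑[ x ← xs ] ∑[ y ← ys ] f x y ≡ ∑[ y ← ys ] ∑[ x ← xs ] f x y
∑-swap []       ys f = sym (trans (∑-const ys 0) (*-zeroʳ (length ys)))
∑-swap (x ∷ xs) ys f = trans (cong (∑ ys (f x) +_) (∑-swap xs ys f))
                             (sym (∑-distrib-+ ys (f x) (λ y → ∑[ x ← xs ] f x y)))

sum-concatMap : (f : A → List ℕ) (xs : List A) → sum (concatMap f xs) ≡ ∑[ x ← xs ] sum (f x)
sum-concatMap f []       = refl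
sum-concatMap f (x ∷ xs) = trans (sum-++ (f x) (concatMap f xs)) (cong (sum (f x) +_) (sum-concatMap f xs))

∑-map : (g : A → B) (xs : List A) (f : B → ℕ) → ∑ (map g xs) f ≡ ∑[ x ← xs ] f (g x)
∑-map g xs f = cong sum (sym (map-∘ xs))

∑-concatMap : (g : A → List B) (xs : List A) (f : B → ℕ) →
              ∑ (concatMap g xs) f ≡ ∑[ x ← xs ] ∑ (g x) f
∑-concatMap g xs f = trans (cong sum (map-concatMap f g xs)) (sum-concatMap (map f ∘ g) xs)

∑-allVecs-suc : (xs : List A) (k : ℕ) (f : Vec A (suc k) → ℕ) →
                ∑ (allVecs xs (suc k)) f ≡ ∑[ x ← xs ] ∑[ v ← allVecs xs k ] f (x ∷ v)
∑-allVecs-suc xs k f = trans (∑-concatMap (λ x → map (x ∷_) (allVecs xs k)) xs f)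
                             (∑-cong xs (λ x → ∑-map (x ∷_) (allVecs xs k) f))

length-allVecs-suc : (xs : List A) (k : ℕ) →
                     length (allVecs xs (suc k)) ≡ length xs * length (allVecs xs k)
length-allVecs-suc xs k = begin
  length (allVecs xs (suc k))         ≡⟨ ∑-one (allVecs xs (suc k)) ⟨
  ∑[ v ← allVecs xs (suc k) ] 1       ≡⟨ ∑-allVecs-suc xs k (λ _ → 1) ⟩
  ∑[ x ← xs ] ∑[ v ← allVecs xs k ] 1 ≡⟨ ∑-cong xs (λ _ → ∑-one (allVecs xs k)) ⟩
  ∑[ x ← xs ] length (allVecs xs k)   ≡⟨ ∑-const xs _ ⟩
  length xs * length (allVecs xs k)   ∎
  where open ≡-Reasoning

length-allVecs : (xs : List A) (k : ℕ) → length (allVecs xs k) ≡ length xs ^ k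
length-allVecs xs zero    = refl
length-allVecs xs (suc k) = trans (length-allVecs-suc xs k) (cong (length xs *_) (length-allVecs xs k))

length-allVecs-suc-* : (xs : List A) (k c : ℕ) →
                       length (allVecs xs (suc k)) * c ≡ length xs * (length (allVecs xs k) * c)
length-allVecs-suc-* xs k c =
  trans (cong (_* c) (length-allVecs-suc xs k)) (*-assoc (length xs) (length (allVecs xs k)) c)

-- The image under π of the uniform distribution on ys is the uniform distribution on xs,
-- with the denominators of both means cleared.
MapsUniformly : (A → B) → List A → List B → Set
MapsUniformly π ys xs = ∀ h → length xs * ∑[ y ← ys ] h (π y) ≡ length ys * ∑ xs h

mapsUniformly-mean-≤ : {π : A → B} {ys : List A} {xs : List B} → MapsUniformly π ys xs →
                       .{{NonZero (length xs)}} → (h : B → ℕ) (c : ℕ) →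
                       ∑ xs h ≤ c * length xs → ∑[ y ← ys ] h (π y) ≤ c * length ys
mapsUniformly-mean-≤ {π = π} {ys} {xs} uπ h c mean≤c = *-cancelˡ-≤ (length xs) (begin
  length xs * ∑[ y ← ys ] h (π y) ≡⟨ uπ h ⟩
  length ys * ∑ xs h              ≤⟨ *-monoʳ-≤ (length ys) mean≤c ⟩
  length ys * (c * length xs)     ≡⟨ x∙yz≈y∙xz (length ys) c (length xs) ⟩
  c * (length ys * length xs)     ≡⟨ cong (c *_) (*-comm (length ys) (length xs)) ⟩
  c * (length xs * length ys)     ≡⟨ x∙yz≈y∙xz c (length xs) (length ys) ⟩
  length xs * (c * length ys)     ∎)
  where open ≤-Reasoning

lookup-mapsUniformly : (xs : List A) {k : ℕ} (j : Fin k) →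
                       MapsUniformly (λ v → lookup v j) (allVecs xs k) xs
lookup-mapsUniformly xs {suc k} zero h = begin
  length xs * ∑[ v ← allVecs xs (suc k) ] h (lookup v zero)
    ≡⟨ cong (length xs *_) (∑-allVecs-suc xs k _) ⟩
  length xs * ∑[ x ← xs ] ∑[ v ← allVecs xs k ] h x
    ≡⟨ cong (length xs *_) (∑-cong xs (λ x → ∑-const (allVecs xs k) (h x))) ⟩
  length xs * ∑[ x ← xs ] (length (allVecs xs k) * h x)
    ≡⟨ cong (length xs *_) (∑-*ˡ xs (length (allVecs xs k)) h) ⟩
  length xs * (length (allVecs xs k) * ∑ xs h)
    ≡⟨ length-allVecs-suc-* xs k (∑ xs h) ⟨
  length (allVecs xs (suc k)) * ∑ xs h
    ∎
  where open ≡-Reasoning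
lookup-mapsUniformly xs {suc k} (suc j) h = begin
  length xs * ∑[ v ← allVecs xs (suc k) ] h (lookup v (suc j))
    ≡⟨ cong (length xs *_) (∑-allVecs-suc xs k _) ⟩
  length xs * ∑[ x ← xs ] ∑[ v ← allVecs xs k ] h (lookup v j)
    ≡⟨ cong (length xs *_) (∑-const xs _) ⟩
  length xs * (length xs * ∑[ v ← allVecs xs k ] h (lookup v j))
    ≡⟨ cong (length xs *_) (lookup-mapsUniformly xs j h) ⟩
  length xs * (length (allVecs xs k) * ∑ xs h)
    ≡⟨ length-allVecs-suc-* xs k (∑ xs h) ⟨
  length (allVecs xs (suc k)) * ∑ xs h
    ∎
  where open ≡-Reasoning

map-mapsUniformly : {π : A → B} {ys : List A} {xs : List B} (m : ℕ) → MapsUniformly π ys xs →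
                    MapsUniformly (V.map π) (allVecs ys m) (allVecs xs m)
map-mapsUniformly zero    uπ g = refl
map-mapsUniformly {π = π} {ys} {xs} (suc m) uπ g = begin
  length (allVecs xs (suc m)) * ∑[ v ← allVecs ys (suc m) ] g (V.map π v)
    ≡⟨ cong₂ _*_ (length-allVecs-suc xs m) (∑-allVecs-suc ys m _) ⟩
  (length xs * length Xs) * ∑[ y ← ys ] ∑[ v ← Ys ] g (π y ∷ V.map π v)
    ≡⟨ cong₂ _*_ (*-comm (length xs) (length Xs)) (∑-swap ys Ys _) ⟩
  (length Xs * length xs) * ∑[ v ← Ys ] ∑[ y ← ys ] g (π y ∷ V.map π v)
    ≡⟨ *-assoc (length Xs) (length xs) _ ⟩
  length Xs * (length xs * ∑[ v ← Ys ] ∑[ y ← ys ] g (π y ∷ V.map π v))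
    ≡⟨ cong (length Xs *_) (∑-*ˡ Ys (length xs) _) ⟨
  length Xs * ∑[ v ← Ys ] (length xs * ∑[ y ← ys ] g (π y ∷ V.map π v))
    ≡⟨ cong (length Xs *_) (∑-cong Ys (λ v → uπ (λ x → g (x ∷ V.map π v)))) ⟩
  length Xs * ∑[ v ← Ys ] (length ys * g₁ (V.map π v))
    ≡⟨ cong (length Xs *_) (∑-*ˡ Ys (length ys) _) ⟩
  length Xs * (length ys * ∑[ v ← Ys ] g₁ (V.map π v))
    ≡⟨ x∙yz≈y∙xz (length Xs) (length ys) _ ⟩
  length ys * (length Xs * ∑[ v ← Ys ] g₁ (V.map π v))
    ≡⟨ cong (length ys *_) (map-mapsUniformly m uπ g₁) ⟩
  length ys * (length Ys * ∑ Xs g₁)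
    ≡⟨ length-allVecs-suc-* ys m (∑ Xs g₁) ⟨
  length (allVecs ys (suc m)) * ∑[ c ← Xs ] ∑[ x ← xs ] g (x ∷ c)
    ≡⟨ cong (length (allVecs ys (suc m)) *_) (∑-swap Xs xs _) ⟩
  length (allVecs ys (suc m)) * ∑[ x ← xs ] ∑[ c ← Xs ] g (x ∷ c)
    ≡⟨ cong (length (allVecs ys (suc m)) *_) (∑-allVecs-suc xs m g) ⟨
  length (allVecs ys (suc m)) * ∑ (allVecs xs (suc m)) g
    ∎
  where
  open ≡-Reasoning
  Xs : List (Vec _ m)
  Xs = allVecs xs m
  Ys : List (Vec _ m)
  Ys = allVecs ys m
  g₁ : Vec _ m → ℕ
  g₁ c = ∑[ x ← xs ] g (x ∷ c)

bits : List Bool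
bits = true ∷ false ∷ []

column-mapsUniformly : {n : ℕ} (j : Fin n) →
                       MapsUniformly (λ B → column B j) (allBoolMatrices n) (allVecs bits n)
column-mapsUniformly {n} j = map-mapsUniformly n (lookup-mapsUniformly bits j)

∑-examined-keepWhere-≤ : {m : ℕ} (a : Vec Bool m) →
                         ∑[ c ← allVecs bits m ] examined (keepWhere a c) ≤ 2 * 2 ^ m
∑-examined-keepWhere-≤ [] = z≤n
∑-examined-keepWhere-≤ {suc m} (false ∷ a) = begin
  ∑[ c ← allVecs bits (suc m) ] examined (keepWhere (false ∷ a) c)
    ≡⟨ ∑-allVecs-suc bits m _ ⟩
  2 * ∑[ c ← allVecs bits m ] examined (keepWhere a c)
    ≤⟨ *-monoʳ-≤ 2 (∑-examined-keepWhere-≤ a) ⟩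
  2 * (2 * 2 ^ m)
    ∎
  where open ≤-Reasoning
∑-examined-keepWhere-≤ {suc m} (true ∷ a) = begin
  ∑[ c ← allVecs bits (suc m) ] examined (keepWhere (true ∷ a) c)
    ≡⟨ ∑-allVecs-suc bits m _ ⟩
  ∑[ c ← Cs ] 1 + (∑[ c ← Cs ] suc (examined (keepWhere a c)) + 0)
    ≡⟨ cong₂ (λ s t → s + (t + 0)) (∑-one Cs) (∑-suc Cs _) ⟩
  length Cs + ((length Cs + ∑[ c ← Cs ] examined (keepWhere a c)) + 0)
    ≤⟨ +-monoʳ-≤ (length Cs) (+-monoˡ-≤ 0 (+-monoʳ-≤ (length Cs) (∑-examined-keepWhere-≤ a))) ⟩
  length Cs + ((length Cs + 2 * 2 ^ m) + 0)
    ≡⟨ cong (λ l → l + ((l + 2 * 2 ^ m) + 0)) (length-allVecs bits m) ⟩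
  2 ^ m + ((2 ^ m + 2 * 2 ^ m) + 0)
    ≡⟨ x+[x+2x]≡2[2x] (2 ^ m) ⟩
  2 * (2 * 2 ^ m)
    ∎
  where
  open ≤-Reasoning
  Cs : List (Vec Bool m)
  Cs = allVecs bits m
  x+[x+2x]≡2[2x] : ∀ x → x + ((x + 2 * x) + 0) ≡ 2 * (2 * x)
  x+[x+2x]≡2[2x] = solve-∀

∑-examined-column-≤ : {n : ℕ} (a : Vec Bool n) (j : Fin n) →
                      ∑[ B ← allBoolMatrices n ] examined (keepWhere a (column B j))
                        ≤ 2 * length (allBoolMatrices n)
∑-examined-column-≤ {n} a j =
  mapsUniformly-mean-≤ {ys = allBoolMatrices n} {xs = allVecs bits n}
    (column-mapsUniformly j) {{length-bitVectors≢0}} (examined ∘ keepWhere a) 2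
    (subst (λ l → ∑[ c ← allVecs bits n ] examined (keepWhere a c) ≤ 2 * l)
           (sym (length-allVecs bits n)) (∑-examined-keepWhere-≤ a))
  where
  length-bitVectors≢0 : NonZero (length (allVecs bits n))
  length-bitVectors≢0 = subst NonZero (sym (length-allVecs bits n)) (m^n≢0 2 n)

rowCost : {n : ℕ} → Vec Bool n → BoolMatrix n → ℕ
rowCost {n} a B = n + ∑[ j ← allFin n ] suc (examined (keepWhere a (column B j)))

∑-rowCost-≤ : {n : ℕ} (a : Vec Bool n) →
              ∑[ B ← allBoolMatrices n ] rowCost a B ≤ 4 * n * length (allBoolMatrices n)
∑-rowCost-≤ {n} a = begin
  ∑[ B ← Bs ] (n + ∑[ j ← allFin n ] suc (e j B))
    ≡⟨ ∑-distrib-+ Bs (λ _ → n) _ ⟩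
  ∑[ B ← Bs ] n + ∑[ B ← Bs ] ∑[ j ← allFin n ] suc (e j B)
    ≡⟨ cong₂ _+_ (∑-const Bs n) (∑-swap Bs (allFin n) _) ⟩
  N * n + ∑[ j ← allFin n ] ∑[ B ← Bs ] suc (e j B)
    ≤⟨ +-monoʳ-≤ (N * n) (∑-bound (allFin n) ∑-suc-e≤3N) ⟩
  N * n + length (allFin n) * (3 * N)
    ≡⟨ cong (λ l → N * n + l * (3 * N)) (length-tabulate {n = n} _) ⟩
  N * n + n * (3 * N)
    ≡⟨ Nn+n[3N]≡4nN N n ⟩
  4 * n * N
    ∎
  where
  open ≤-Reasoning
  Bs : List (BoolMatrix n)
  Bs = allBoolMatrices n
  N : ℕ
  N = length Bs
  e : Fin n → BoolMatrix n → ℕ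
  e j B = examined (keepWhere a (column B j))
  ∑-suc-e≤3N : (j : Fin n) → ∑[ B ← Bs ] suc (e j B) ≤ 3 * N
  ∑-suc-e≤3N j = begin
    ∑[ B ← Bs ] suc (e j B) ≡⟨ ∑-suc Bs (e j) ⟩
    N + ∑ Bs (e j)          ≤⟨ +-monoʳ-≤ N (∑-examined-column-≤ a j) ⟩
    N + 2 * N               ∎
  Nn+n[3N]≡4nN : ∀ N n → N * n + n * (3 * N) ≡ 4 * n * N
  Nn+n[3N]≡4nN = solve-∀

totalCost≡∑∑∑rowCost : (n : ℕ) →
  totalCost n ≡
    ∑[ A ← allBoolMatrices n ] ∑[ i ← allFin n ] ∑[ B ← allBoolMatrices n ] rowCost (lookup A i) B
totalCost≡∑∑∑rowCost n =
  trans (sum-concatMap _ (allBoolMatrices n))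
        (∑-cong (allBoolMatrices n) (λ A →
          ∑-swap (allBoolMatrices n) (allFin n) (λ B i → rowCost (lookup A i) B)))

length-allBoolMatrices : (n : ℕ) → length (allBoolMatrices n) ≡ 2 ^ (n * n)
length-allBoolMatrices n = begin
  length (allVecs (allVecs bits n) n) ≡⟨ length-allVecs (allVecs bits n) n ⟩
  length (allVecs bits n) ^ n         ≡⟨ cong (_^ n) (length-allVecs bits n) ⟩
  (2 ^ n) ^ n                         ≡⟨ ^-*-assoc 2 n n ⟩
  2 ^ (n * n)                         ∎
  where open ≡-Reasoning

length-allBoolMatrices² : (n : ℕ) →
  length (allBoolMatrices n) * length (allBoolMatrices n) ≡ 2 ^ (2 * (n * n))
length-allBoolMatrices² n = begin
  length (allBoolMatrices n) * length (allBoolMatrices n)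
    ≡⟨ cong₂ _*_ (length-allBoolMatrices n) (length-allBoolMatrices n) ⟩
  2 ^ (n * n) * 2 ^ (n * n)  ≡⟨ ^-distribˡ-+-* 2 (n * n) (n * n) ⟨
  2 ^ (n * n + n * n)        ≡⟨ cong (λ k → 2 ^ (n * n + k)) (+-identityʳ (n * n)) ⟨
  2 ^ (2 * (n * n))          ∎
  where open ≡-Reasoning

theorem3 : ∃ λ (c : ℕ) → ∀ (n : ℕ) → totalCost n ≤ c * (n * n) * 2 ^ (2 * (n * n))
theorem3 = 4 , λ n → let N = length (allBoolMatrices n) in begin
  totalCost n
    ≡⟨ totalCost≡∑∑∑rowCost n ⟩
  ∑[ A ← allBoolMatrices n ] ∑[ i ← allFin n ] ∑[ B ← allBoolMatrices n ] rowCost (lookup A i) B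
    ≤⟨ ∑-bound (allBoolMatrices n) (λ A → ∑-bound (allFin n) (λ i → ∑-rowCost-≤ (lookup A i))) ⟩
  N * (length (allFin n) * (4 * n * N))
    ≡⟨ cong (λ l → N * (l * (4 * n * N))) (length-tabulate {n = n} _) ⟩
  N * (n * (4 * n * N))
    ≡⟨ N[n[4nN]]≡4[nn][NN] N n ⟩
  4 * (n * n) * (N * N)
    ≡⟨ cong (4 * (n * n) *_) (length-allBoolMatrices² n) ⟩
  4 * (n * n) * 2 ^ (2 * (n * n))
    ∎
  where
  open ≤-Reasoning
  N[n[4nN]]≡4[nn][NN] : ∀ N n → N * (n * (4 * n * N)) ≡ 4 * (n * n) * (N * N)
  N[n[4nN]]≡4[nn][NN] = solve-∀
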